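{- Let $p$ be a prime, $q=p^t\ge 4$, $n\ge 2$, and let $\mathcal{D}$ be an affine resolvable $2$-$(q^n,q^{n-1},(q^{n-1}-1)/(q-1))$ design with a good block $B$. Let $\mathcal{D}''$ be the substructure of the residual design $\mathcal{D}_B$ consisting of all its blocks of size $q^{n-1}-q^{n-2}$, let $M''$ be its point-by-block incidence matrix, and let $R$ be the resolution of $\mathcal{D}''$ defined by $B$. If $\mathcal{D}_B$ is linearly embeddable over $GF(p)$, then the linear code over $GF(p)$ of length $q^2(q^{n-1}-1)/(q-1)$ spanned by the rows of $M''$ contains at least $(p-1)\binom{q^{n-1}}{2}$ codewords of weight $2q^{n-1}$ whose supports (as sets of blocks of $\mathcal{D}''$) are unions of parallel classes of $R$.
   Context: A $2$-$(v,k,\lambda)$ design has $v$ points, blocks of size $k$, and every pair of points in exactly $\lambda$ blocks. A parallel class is a set of pairwise disjoint blocks partitioning the point set; a resolution is a partition of the blocks into parallel classes; a $2$-$(v,k,\lambda)$ design with $v=qk$ is affine resolvable if it is resolvable and has $b=v+r-1$ blocks ($r$ the replication number); equivalently it is resolvable and any two non-parallel blocks meet in a constant number of points (here $q^{n-2}$). For a block $B$ of a design $\mathcal{D}=(X,\mathcal{B})$, the residual design $\mathcal{D}_B$ has point set $X\setminus B$ and blocks $B_j\setminus B$ for all blocks $B_j\ne B$; it is linearly embeddable over $GF(p)$ if $\mathrm{rank}_p A=\mathrm{rank}_p A''+1$, where $A,A''$ are the incidence matrices of $\mathcal{D}$ and $\mathcal{D}_B$. A block $B$ of an affine resolvable $2$-$(q^n,q^{n-1},(q^{n-1}-1)/(q-1))$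 design is good if the nonempty intersections $B\cap B_j$ ($B_j\ne B$) form, as a multiset, a $2$-$(q^{n-1},q^{n-2},q(q^{n-2}-1)/(q-1))$ design on $B$ whose block collection is the union of $q$ identical copies of the block set of a simple $2$-$(q^{n-1},q^{n-2},(q^{n-2}-1)/(q-1))$ design $S$. In this case, for each block $T$ of $S$, the $q$ blocks $B_j$ with $B\cap B_j=T$ give $q$ pairwise disjoint blocks $B_j\setminus B$ of $\mathcal{D}''$ forming a parallel class of $\mathcal{D}''$; these parallel classes, indexed by the blocks of $S$, constitute the resolution $R$ of $\mathcal{D}''$ defined by $B$. -}

module Defs where

open import Data.Nat as ℕ using (ℕ; zero; suc; _+_; _*_; _∸_; _^_; _≤_)
open import Data.Nat.Divisibility using (_∣_; _∣?_)
open import Data.Integer as ℤ using (ℤ; ∣_∣) renaming (_+_ to _+ℤ_; _*_ to _*ℤ_; _-_ to _-ℤ_)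
open import Data.Fin using (Fin; zero; suc; _≟_)
open import Data.Bool using (Bool; true; false; _∧_; not; if_then_else_)
open import Data.Product using (Σ; ∃; ∃-syntax; _×_; _,_)
open import Relation.Nullary using (¬_)
open import Relation.Nullary.Decidable using (⌊_⌋)
open import Relation.Binary.PropositionalEquality using (_≡_; _≢_)

FSet : ℕ → Set
FSet n = Fin n → Bool

count : ∀ {n} → (Fin n → Bool) → ℕ
count {zero}  f = 0
count {suc n} f = (if f zero then 1 else 0) + count (λ i → f (suc i))

sumℤ : ∀ {n} → (Fin n → ℤ) → ℤ
sumℤ {zero}  f = ℤ.+ 0
sumℤ {suc n} f = f zero +ℤ sumℤ (λ i → f (suc i))

allF : ∀ {n} → (Fin n → Bool) → Bool
allF {zero}  f = true
allF {suc n} f = f zero ∧ allF (λ i → f (suc i))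

_∩_ : ∀ {n} → FSet n → FSet n → FSet n
(A ∩ B) x = A x ∧ B x

_─_ : ∀ {n} → FSet n → FSet n → FSet n
(A ─ B) x = A x ∧ not (B x)

_⊆_ : ∀ {n} → FSet n → FSet n → Set
A ⊆ B = ∀ x → A x ≡ true → B x ≡ true

SameSet : ∀ {n} → FSet n → FSet n → Set
SameSet A B = ∀ x → A x ≡ B x

boolEq : Bool → Bool → Bool
boolEq true  b = b
boolEq false b = not b

sameSetᵇ : ∀ {n} → FSet n → FSet n → Bool
sameSetᵇ A B = allF (λ x → boolEq (A x) (B x))

Nonempty : ∀ {n} → FSet n → Set
Nonempty A = ∃[ x ] A x ≡ true

neqᵇ : ∀ {b} → Fin b → Fin b → Bool
neqᵇ j β = not ⌊ j ≟ β ⌋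

-- Designs: a design with v points and b blocks is a family of b blocks
-- (repeated blocks allowed) indexed by Fin b, each a subset of Fin v.

Design : ℕ → ℕ → Set
Design v b = Fin b → FSet v

Is2Design : ∀ {v b} → Design v b → (k lam : ℕ) → Set
Is2Design {v} {b} D k lam =
  (∀ j → count (D j) ≡ k) ×
  (∀ (x y : Fin v) → x ≢ y → count (λ j → D j x ∧ D j y) ≡ lam)

-- cls : Fin b → Fin c assigns each block to a parallel class;
-- each class is a set of pairwise disjoint blocks covering all points.
IsResolution : ∀ {v b c} → Design v b → (Fin b → Fin c) → Set
IsResolution {v} {b} {c} D cls =
  (∀ (j j' : Fin b) → j ≢ j' → cls j ≡ cls j' →
     ∀ x → ¬ (D j x ≡ true × D j' x ≡ true)) ×
  (∀ (i : Fin c) (x : Fin v) → ∃[ j ] (cls j ≡ i × D j x ≡ true))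

Resolvable : ∀ {v b} → Design v b → Set
Resolvable {v} {b} D = ∃[ c ] Σ (Fin b → Fin c) (IsResolution D)

AffineResolvable : ∀ {v b} → Design v b → (k lam : ℕ) → Set
AffineResolvable {v} {b} D k lam =
  Is2Design D k lam × Resolvable D ×
  (∃[ r ] ((∀ x → count (λ j → D j x) ≡ r) × b ≡ v + r ∸ 1))

-- S is a simple 2-(q^(n-1), q^(n-2), μ) design on the point set of B
-- (μ = (q^(n-2)-1)/(q-1)), given by blocks T : Fin s → FSet v with T i ⊆ B;
-- the nonempty intersections B ∩ B_j (j ≠ B), as a multiset, are exactly
-- q copies of the blocks of S, and form a 2-(q^(n-1), q^(n-2), qμ) design on B.

GoodBlock : ∀ {v b} → (q n : ℕ) → Design v b → Fin b → Set
GoodBlock {v} {b} q n D β =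
  ∃[ μ ] ((q ∸ 1) * μ ≡ q ^ (n ∸ 2) ∸ 1 ×
  ∃[ s ] Σ (Fin s → FSet v) λ T →
    (∀ i → T i ⊆ D β) ×
    (∀ i i' → i ≢ i' → ¬ SameSet (T i) (T i')) ×
    (∀ i → count (T i) ≡ q ^ (n ∸ 2)) ×
    (∀ x y → x ≢ y → D β x ≡ true → D β y ≡ true →
       count (λ i → T i x ∧ T i y) ≡ μ) ×
    (∀ x y → x ≢ y → D β x ≡ true → D β y ≡ true →
       count (λ j → neqᵇ j β ∧ (D j x ∧ D j y)) ≡ q * μ) ×
    (∀ j → j ≢ β → Nonempty (D β ∩ D j) → ∃[ i ] SameSet (D β ∩ D j) (T i)) ×
    (∀ i → count (λ j → neqᵇ j β ∧ sameSetᵇ (D β ∩ D j) (T i)) ≡ q))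

-- Linear algebra over GF(p), with GF(p) = ℤ/pℤ represented by ℤ
-- (two integers represent the same element iff p divides their difference).

_≡_[mod_] : ℤ → ℤ → ℕ → Set
x ≡ y [mod p ] = p ∣ ∣ x -ℤ y ∣

nonzeroᵇ : ℕ → ℤ → Bool
nonzeroᵇ p x = not ⌊ p ∣? ∣ x ∣ ⌋

-- Rank over GF(p) of the submatrix of M : Fin m → Fin c → ℤ formed by
-- the rows with rowP ≡ true and the columns with colP ≡ true:
-- HasRank p M rowP colP r  means some r of those rows are linearly
-- independent over GF(p) and span all those rows (i.e. the row space
-- has dimension r).
HasRank : ∀ {m c} → ℕ → (Fin m → Fin c → ℤ) → (Fin m → Bool) → (Fin c → Bool) → ℕ → Set
HasRank {m} {c} p M rowP colP r =
  Σ (Fin r → Fin m) λ sel →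
    (∀ i → rowP (sel i) ≡ true) ×
    (∀ (a : Fin r → ℤ) →
       (∀ col → colP col ≡ true →
          sumℤ (λ i → a i *ℤ M (sel i) col) ≡ ℤ.+ 0 [mod p ]) →
       ∀ i → a i ≡ ℤ.+ 0 [mod p ]) ×
    (∀ x → rowP x ≡ true → Σ (Fin r → ℤ) λ a → ∀ col → colP col ≡ true →
       M x col ≡ sumℤ (λ i → a i *ℤ M (sel i) col) [mod p ])

incidence : ∀ {v b} → Design v b → Fin v → Fin b → ℤ
incidence D x j = if D j x then ℤ.+ 1 else ℤ.+ 0

-- Residual design D_B: points X \ B, blocks B_j \ B (j ≠ B).
-- Its incidence matrix is the submatrix of that of D with rows x ∉ B
-- and columns j ≠ B.
residualRows : ∀ {v b} → Design v b → Fin b → Fin v → Bool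
residualRows D β x = not (D β x)

residualCols : ∀ {b} → Fin b → Fin b → Bool
residualCols β j = neqᵇ j β

-- D_B is linearly embeddable over GF(p): rank_p A = rank_p A'' + 1
LinearlyEmbeddable : ∀ {v b} → ℕ → Design v b → Fin b → Set
LinearlyEmbeddable {v} {b} p D β =
  ∃[ r ] (HasRank p (incidence D) (λ _ → true) (λ _ → true) (suc r) ×
          HasRank p (incidence D) (residualRows D β) (residualCols β) r)

inD''ᵇ : ∀ {v b} → (q n : ℕ) → Design v b → Fin b → Fin b → Bool
inD''ᵇ q n D β j =
  neqᵇ j β ∧ (count (D j ─ D β) ℕ.≡ᵇ (q ^ (n ∸ 1) ∸ q ^ (n ∸ 2)))

-- The codeword of the row space of M'' (incidence matrix of D'') with
-- coefficient vector a (indexed by the points x ∉ B), evaluated at the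
-- column of block j.  Only columns j with inD''ᵇ j ≡ true are coordinates
-- of the code.
codeword : ∀ {v b} → Design v b → Fin b → (Fin v → ℤ) → Fin b → ℤ
codeword D β a j =
  sumℤ (λ x → if D β x then ℤ.+ 0 else a x *ℤ incidence D x j)

-- For points x ≠ y of the good block B, linear embeddability (rank A = rank A'' + 1) yields a
-- relation over GF(p) among the rows x, y of A and a basis of the rows of A''.  Read at the column
-- of B it shows that G (row x - row y) with G ≢ 0 (mod p), restricted to the blocks other than B,
-- lies in the row space of A''.  This codeword is nonzero exactly on the blocks containing one of
-- x, y; they meet B, so they belong to D'', and whether a block qualifies depends only on its
-- trace on B, that is on its parallel class in R.  With K = q^(n-2) and μ = (K - 1)/(q - 1), a
-- point of B lies on q(K + μ) further blocks and two points on qμ, so the weight is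
-- 2q(K + μ) - 2qμ = 2q^(n-1).  Scaling by the p - 1 nonzero residues and letting {x, y} range
-- over the pairs of points of B gives distinct codewords, because q(K + μ) > 3qμ for q ≥ 4:
-- some block through a point of B avoids any three other points of B.
module Submission where

open import Defs
open import Data.Nat as ℕ using (ℕ; zero; suc; z≤n; s≤s)
import Data.Nat.Properties as ℕP
open import Data.Nat.Primality using (Prime)
open import Data.Nat.Combinatorics using (_C_)
open import Data.Fin as Fin using (Fin; punchIn; toℕ)
import Data.Fin.Properties as FinP
open import Data.Bool using (Bool; true; false; not; _∧_; _∨_; _xor_; if_then_else_)
import Data.Bool.Properties as BoolP
open import Data.Product using (Σ; ∃-syntax; _×_; _,_; proj₁; proj₂; uncurry)
open import Data.Sum using (inj₁; inj₂)
open import Data.Empty using (⊥; ⊥-elim)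
open import Data.Vec.Functional using (insertAt; _∷_)
open import Data.Vec.Functional.Properties using (insertAt-lookup; insertAt-punchIn)
open import Function using (_∘_; case_of_; Equivalence)
open import Relation.Nullary using (¬_; Dec; yes; no; ¬?)
open import Relation.Nullary.Decidable using (⌊_⌋)
open import Relation.Binary.PropositionalEquality

module IntegerSums where
  open import Data.Integer using (ℤ; 0ℤ; _+_; _*_)
  import Data.Integer.Properties as ℤP
  open import Algebra.Properties.Semiring.Sum ℤP.+-*-semiring
    using (sum; ∑-distrib-+; ∑-comm; sum-remove; *-distribˡ-sum; *-distribʳ-sum; sum-replicate-zero)

  sumℤ≡sum : ∀ {n} (f : Fin n → ℤ) → sumℤ f ≡ sum f
  sumℤ≡sum {zero}  f = refl
  sumℤ≡sum {suc n} f = cong (f Fin.zero +_) (sumℤ≡sum (f ∘ Fin.suc))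

  sumℤ-cong : ∀ {n} {f g : Fin n → ℤ} → (∀ i → f i ≡ g i) → sumℤ f ≡ sumℤ g
  sumℤ-cong {zero}  f≗g = refl
  sumℤ-cong {suc n} f≗g = cong₂ _+_ (f≗g Fin.zero) (sumℤ-cong (f≗g ∘ Fin.suc))

  sumℤ-zero : ∀ n → sumℤ {n} (λ _ → 0ℤ) ≡ 0ℤ
  sumℤ-zero n = trans (sumℤ≡sum {n} _) (sum-replicate-zero n)

  sumℤ-distrib-+ : ∀ {n} (f g : Fin n → ℤ) → sumℤ (λ i → f i + g i) ≡ sumℤ f + sumℤ g
  sumℤ-distrib-+ f g = begin
    sumℤ (λ i → f i + g i)  ≡⟨ sumℤ≡sum (λ i → f i + g i) ⟩
    sum (λ i → f i + g i)   ≡⟨ ∑-distrib-+ f g ⟩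
    sum f + sum g           ≡⟨ cong₂ _+_ (sumℤ≡sum f) (sumℤ≡sum g) ⟨
    sumℤ f + sumℤ g         ∎
    where open ≡-Reasoning

  sumℤ-distribˡ : ∀ {n} (c : ℤ) (f : Fin n → ℤ) → sumℤ (λ i → c * f i) ≡ c * sumℤ f
  sumℤ-distribˡ c f = begin
    sumℤ (λ i → c * f i)  ≡⟨ sumℤ≡sum (λ i → c * f i) ⟩
    sum (λ i → c * f i)   ≡⟨ *-distribˡ-sum c f ⟨
    c * sum f             ≡⟨ cong (c *_) (sumℤ≡sum f) ⟨
    c * sumℤ f            ∎
    where open ≡-Reasoning

  sumℤ-distribʳ : ∀ {n} (c : ℤ) (f : Fin n → ℤ) → sumℤ (λ i → f i * c) ≡ sumℤ f * c
  sumℤ-distribʳ c f = begin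
    sumℤ (λ i → f i * c)  ≡⟨ sumℤ≡sum (λ i → f i * c) ⟩
    sum (λ i → f i * c)   ≡⟨ *-distribʳ-sum c f ⟨
    sum f * c             ≡⟨ cong (_* c) (sumℤ≡sum f) ⟨
    sumℤ f * c            ∎
    where open ≡-Reasoning

  sumℤ-comm : ∀ {m n} (f : Fin m → Fin n → ℤ) →
              sumℤ (λ i → sumℤ (λ j → f i j)) ≡ sumℤ (λ j → sumℤ (λ i → f i j))
  sumℤ-comm f = begin
    sumℤ (λ i → sumℤ (f i))            ≡⟨ sumℤ-cong (λ i → sumℤ≡sum (f i)) ⟩
    sumℤ (λ i → sum (f i))             ≡⟨ sumℤ≡sum (λ i → sum (f i)) ⟩
    sum (λ i → sum (f i))              ≡⟨ ∑-comm f ⟩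
    sum (λ j → sum (λ i → f i j))      ≡⟨ sumℤ≡sum (λ j → sum (λ i → f i j)) ⟨
    sumℤ (λ j → sum (λ i → f i j))     ≡⟨ sumℤ-cong (λ j → sumℤ≡sum (λ i → f i j)) ⟨
    sumℤ (λ j → sumℤ (λ i → f i j))    ∎
    where open ≡-Reasoning

  sumℤ-remove : ∀ {n} (f : Fin (suc n) → ℤ) (k : Fin (suc n)) →
                sumℤ f ≡ f k + sumℤ (λ i → f (punchIn k i))
  sumℤ-remove f k = begin
    sumℤ f                            ≡⟨ sumℤ≡sum f ⟩
    sum f                             ≡⟨ sum-remove {i = k} f ⟩
    f k + sum (λ i → f (punchIn k i))  ≡⟨ cong (f k +_) (sumℤ≡sum (f ∘ punchIn k)) ⟨
    f k + sumℤ (λ i → f (punchIn k i)) ∎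
    where open ≡-Reasoning

  sumℤ-δ : ∀ {n} (k : Fin n) (c : ℤ) → sumℤ (λ i → if ⌊ k Fin.≟ i ⌋ then c else 0ℤ) ≡ c
  sumℤ-δ {suc n} k c = begin
    sumℤ δ                                    ≡⟨ sumℤ-remove δ k ⟩
    δ k + sumℤ (λ i → δ (punchIn k i))        ≡⟨ cong₂ _+_ (δ-at-k (k Fin.≟ k)) (sumℤ-cong (λ i → δ-off-k i (k Fin.≟ punchIn k i))) ⟩
    c + sumℤ {n} (λ _ → 0ℤ)                   ≡⟨ cong (c +_) (sumℤ-zero n) ⟩
    c + 0ℤ                                    ≡⟨ ℤP.+-identityʳ c ⟩
    c                                         ∎
    where
    open ≡-Reasoning
    δ : Fin (suc n) → ℤ
    δ i = if ⌊ k Fin.≟ i ⌋ then c else 0ℤ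
    δ-at-k : (k≟k : Dec (k ≡ k)) → (if ⌊ k≟k ⌋ then c else 0ℤ) ≡ c
    δ-at-k (yes _)   = refl
    δ-at-k (no  k≢k) = ⊥-elim (k≢k refl)
    δ-off-k : ∀ i (k≟i : Dec (k ≡ punchIn k i)) → (if ⌊ k≟i ⌋ then c else 0ℤ) ≡ 0ℤ
    δ-off-k i (yes k≡i) = ⊥-elim (FinP.punchInᵢ≢i k i (sym k≡i))
    δ-off-k i (no  _)   = refl

open IntegerSums

module Counting where
  open import Data.Nat using (_+_; _*_; _≤_; _<_)
  open import Algebra.Properties.Semiring.Sum ℕP.+-*-semiring
    using (sum; ∑-distrib-+; ∑-comm; sum-remove; sum-cong-≗)

  indicator : Bool → ℕ
  indicator b = if b then 1 else 0

  count≡sum : ∀ {n} (f : Fin n → Bool) → count f ≡ sum (indicator ∘ f)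
  count≡sum {zero}  f = refl
  count≡sum {suc n} f = cong (indicator (f Fin.zero) +_) (count≡sum (f ∘ Fin.suc))

  sum-const : ∀ n (c : ℕ) → sum {n} (λ _ → c) ≡ n * c
  sum-const zero    c = refl
  sum-const (suc n) c = cong (c +_) (sum-const n c)

  count-cong : ∀ {n} {f g : Fin n → Bool} → (∀ i → f i ≡ g i) → count f ≡ count g
  count-cong {zero}  f≗g = refl
  count-cong {suc n} f≗g = cong₂ (λ a c → indicator a + c) (f≗g Fin.zero) (count-cong (f≗g ∘ Fin.suc))

  count-split : ∀ {n} (f g : Fin n → Bool) → count f ≡ count (λ i → f i ∧ g i) + count (λ i → f i ∧ not (g i))
  count-split {zero}  f g = refl
  count-split {suc n} f g with f Fin.zero | g Fin.zero | count-split (f ∘ Fin.suc) (g ∘ Fin.suc)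
  ... | true  | true  | ih = cong suc ih
  ... | true  | false | ih = trans (cong suc ih) (sym (ℕP.+-suc _ _))
  ... | false | _     | ih = ih

  count-∨-≤ : ∀ {n} (f g h : Fin n → Bool) →
              count (λ i → f i ∧ (g i ∨ h i)) ≤ count (λ i → f i ∧ g i) + count (λ i → f i ∧ h i)
  count-∨-≤ {zero}  f g h = z≤n
  count-∨-≤ {suc n} f g h with f Fin.zero | g Fin.zero | h Fin.zero | count-∨-≤ (f ∘ Fin.suc) (g ∘ Fin.suc) (h ∘ Fin.suc)
  ... | false | _     | _     | ih = ih
  ... | true  | true  | true  | ih = s≤s (ℕP.≤-trans ih (ℕP.+-monoʳ-≤ _ (ℕP.n≤1+n _)))
  ... | true  | true  | false | ih = s≤s ih
  ... | true  | false | true  | ih = ℕP.≤-trans (s≤s ih) (ℕP.≤-reflexive (sym (ℕP.+-suc _ _)))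
  ... | true  | false | false | ih = ih

  count>0⇒∃ : ∀ {n} (f : Fin n → Bool) → 0 < count f → ∃[ i ] f i ≡ true
  count>0⇒∃ {suc n} f 0<count with f Fin.zero in f0
  ... | true  = Fin.zero , f0
  ... | false = let (i , fi) = count>0⇒∃ (f ∘ Fin.suc) 0<count in Fin.suc i , fi

  count-xor : ∀ {n} (m a b : Fin n → Bool) →
    count (λ i → m i ∧ (a i xor b i)) + (count (λ i → m i ∧ (a i ∧ b i)) + count (λ i → m i ∧ (a i ∧ b i)))
    ≡ count (λ i → m i ∧ a i) + count (λ i → m i ∧ b i)
  count-xor {n} m a b = begin
    count X + (count Y + count Y)                ≡⟨ cong₂ (λ s t → s + (t + t)) (count≡sum X) (count≡sum Y) ⟩
    sum (indicator ∘ X) + (sum (indicator ∘ Y) + sum (indicator ∘ Y))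
      ≡⟨ cong (sum (indicator ∘ X) +_) (∑-distrib-+ (indicator ∘ Y) (indicator ∘ Y)) ⟨
    sum (indicator ∘ X) + sum (λ i → indicator (Y i) + indicator (Y i))
      ≡⟨ ∑-distrib-+ (indicator ∘ X) (λ i → indicator (Y i) + indicator (Y i)) ⟨
    sum (λ i → indicator (X i) + (indicator (Y i) + indicator (Y i)))
      ≡⟨ sum-cong-≗ (λ i → pointwise (m i) (a i) (b i)) ⟩
    sum (λ i → indicator (m i ∧ a i) + indicator (m i ∧ b i))
      ≡⟨ ∑-distrib-+ (λ i → indicator (m i ∧ a i)) (λ i → indicator (m i ∧ b i)) ⟩
    sum (λ i → indicator (m i ∧ a i)) + sum (λ i → indicator (m i ∧ b i))
      ≡⟨ cong₂ _+_ (count≡sum (λ i → m i ∧ a i)) (count≡sum (λ i → m i ∧ b i)) ⟨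
    count (λ i → m i ∧ a i) + count (λ i → m i ∧ b i) ∎
    where
    open ≡-Reasoning
    X Y : Fin n → Bool
    X i = m i ∧ (a i xor b i)
    Y i = m i ∧ (a i ∧ b i)
    pointwise : ∀ m a b → indicator (m ∧ (a xor b)) + (indicator (m ∧ (a ∧ b)) + indicator (m ∧ (a ∧ b)))
                          ≡ indicator (m ∧ a) + indicator (m ∧ b)
    pointwise false _     _     = refl
    pointwise true  true  true  = refl
    pointwise true  true  false = refl
    pointwise true  false true  = refl
    pointwise true  false false = refl

  count-remove : ∀ {n} (f : Fin n → Bool) (k : Fin n) →
                 count f ≡ indicator (f k) + count (λ i → neqᵇ i k ∧ f i)
  count-remove {suc n} f k = begin
    count f                                            ≡⟨ count≡sum f ⟩
    sum (indicator ∘ f)                                ≡⟨ sum-remove {i = k} (indicator ∘ f) ⟩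
    indicator (f k) + sum (indicator ∘ f ∘ punchIn k)  ≡⟨ cong (λ s → indicator (f k) + s) (sum-cong-≗ off-k) ⟩
    indicator (f k) + sum (indicator ∘ g ∘ punchIn k)  ≡⟨ cong (λ s → indicator (f k) + (s + sum (indicator ∘ g ∘ punchIn k))) at-k ⟨
    indicator (f k) + (indicator (g k) + sum (indicator ∘ g ∘ punchIn k))
                                                       ≡⟨ cong (λ s → indicator (f k) + s) (sum-remove {i = k} (indicator ∘ g)) ⟨
    indicator (f k) + sum (indicator ∘ g)              ≡⟨ cong (λ s → indicator (f k) + s) (count≡sum g) ⟨
    indicator (f k) + count g                          ∎
    where
    open ≡-Reasoning
    g : Fin (suc n) → Bool
    g i = neqᵇ i k ∧ f i
    at-k : indicator (g k) ≡ 0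
    at-k with k Fin.≟ k
    ... | yes _   = refl
    ... | no  k≢k = ⊥-elim (k≢k refl)
    off-k : ∀ i → indicator (f (punchIn k i)) ≡ indicator (g (punchIn k i))
    off-k i with punchIn k i Fin.≟ k
    ... | yes i≡k = ⊥-elim (FinP.punchInᵢ≢i k i i≡k)
    ... | no  _   = refl

  neqᵇ⇒≢ : ∀ {b} {j k : Fin b} → neqᵇ j k ≡ true → j ≢ k
  neqᵇ⇒≢ {j = j} j≢ᵇj refl with j Fin.≟ j
  ... | yes _ = case j≢ᵇj of λ ()
  ... | no  j≢j = j≢j refl

  double-counting : ∀ {b v k r} (R : Fin b → Fin v → Bool) →
    (∀ j → count (R j) ≡ k) → (∀ x → count (λ j → R j x) ≡ r) → b * k ≡ v * r
  double-counting {b} {v} {k} {r} R row-count column-count = begin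
    b * k                                     ≡⟨ sum-const b k ⟨
    sum {b} (λ j → k)                         ≡⟨ sum-cong-≗ (λ j → trans (sym (row-count j)) (count≡sum (R j))) ⟩
    sum (λ j → sum (λ x → indicator (R j x))) ≡⟨ ∑-comm (λ j x → indicator (R j x)) ⟩
    sum (λ x → sum (λ j → indicator (R j x))) ≡⟨ sum-cong-≗ (λ x → trans (sym (count≡sum (λ j → R j x))) (column-count x)) ⟩
    sum {v} (λ x → r)                         ≡⟨ sum-const v r ⟩
    v * r                                     ∎
    where open ≡-Reasoning

  enumerate : ∀ {v} (f : Fin v → Bool) →
    Σ (Fin (count f) → Fin v) λ e → (∀ i → f (e i) ≡ true) × (∀ i j → e i ≡ e j → i ≡ j)
  enumerate {zero}  f = (λ ()) , (λ ()) , (λ ())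
  enumerate {suc v} f with f Fin.zero in f0 | enumerate (f ∘ Fin.suc)
  ... | false | e , e∈f , e-injective = Fin.suc ∘ e , e∈f , λ i j ei≡ej → e-injective i j (FinP.suc-injective ei≡ej)
  ... | true  | e , e∈f , e-injective = e′ , e′∈f , e′-injective
    where
    e′ : Fin (suc (count (f ∘ Fin.suc))) → Fin (suc v)
    e′ Fin.zero    = Fin.zero
    e′ (Fin.suc i) = Fin.suc (e i)
    e′∈f : ∀ i → f (e′ i) ≡ true
    e′∈f Fin.zero    = f0
    e′∈f (Fin.suc i) = e∈f i
    e′-injective : ∀ i j → e′ i ≡ e′ j → i ≡ j
    e′-injective Fin.zero    Fin.zero    _     = refl
    e′-injective (Fin.suc i) (Fin.suc j) ei≡ej = cong Fin.suc (e-injective i j (FinP.suc-injective ei≡ej))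

open Counting

module Arithmetic where
  open import Data.Nat using (_+_; _*_; _∸_; _≤_; _<_; >-nonZero)
  open import Data.Nat.Tactic.RingSolver using (solve-∀)

  ≡∸1⇒+1≡ : ∀ {a c} → 0 < c → a ≡ c ∸ 1 → a + 1 ≡ c
  ≡∸1⇒+1≡ 0<c a≡c∸1 = trans (cong (_+ 1) a≡c∸1) (ℕP.m∸n+n≡m 0<c)

  lam≡K+μ : ∀ q₁ K μ lam → 0 < q₁ → q₁ * μ + 1 ≡ K → q₁ * lam + 1 ≡ suc q₁ * K → lam ≡ K + μ
  lam≡K+μ q₁ K μ lam 0<q₁ hμ hλ = ℕP.*-cancelˡ-≡ lam (K + μ) q₁ {{>-nonZero 0<q₁}} (ℕP.+-cancelʳ-≡ 1 _ _ (begin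
    q₁ * lam + 1        ≡⟨ hλ ⟩
    suc q₁ * K          ≡⟨ cong (_+ q₁ * K) hμ ⟨
    q₁ * μ + 1 + q₁ * K ≡⟨ regroup q₁ K μ ⟩
    q₁ * (K + μ) + 1    ∎))
    where
    open ≡-Reasoning
    regroup : ∀ q₁ K μ → q₁ * μ + 1 + q₁ * K ≡ q₁ * (K + μ) + 1
    regroup = solve-∀

  -- With v = q k and b = v + N, the double count b k = v (N + 1) reads q k = q₁ N + q after
  -- cancelling k; substituting k = q₁ λ + 1 leaves q₁ q λ = q₁ N.
  other-blocks≡qλ : ∀ q₁ lam N → 0 < q₁ →
    (suc q₁ * (q₁ * lam + 1) + N) * (q₁ * lam + 1) ≡ suc q₁ * (q₁ * lam + 1) * suc N → N ≡ suc q₁ * lam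
  other-blocks≡qλ q₁ lam N 0<q₁ double-count =
    sym (ℕP.*-cancelˡ-≡ (suc q₁ * lam) N q₁ {{>-nonZero 0<q₁}} (ℕP.+-cancelʳ-≡ (suc q₁) _ _ (begin
      q₁ * (suc q₁ * lam) + suc q₁ ≡⟨ expand q₁ lam ⟩
      suc q₁ * k                   ≡⟨ qk≡q₁N+q ⟩
      q₁ * N + suc q₁              ∎)))
    where
    open ≡-Reasoning
    k = q₁ * lam + 1
    expand : ∀ q₁ lam → q₁ * (suc q₁ * lam) + suc q₁ ≡ suc q₁ * (q₁ * lam + 1)
    expand = solve-∀
    lhs : ∀ q₁ k N → (suc q₁ * k + N) * k ≡ suc q₁ * k * k + N * k
    lhs = solve-∀
    rhs : ∀ q₁ k N → suc q₁ * k * suc N ≡ (q₁ * N + suc q₁) * k + N * k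
    rhs = solve-∀
    qk≡q₁N+q : suc q₁ * k ≡ q₁ * N + suc q₁
    qk≡q₁N+q = ℕP.*-cancelʳ-≡ (suc q₁ * k) (q₁ * N + suc q₁) k {{>-nonZero (ℕP.<-≤-trans (s≤s z≤n) (ℕP.m≤n+m 1 (q₁ * lam)))}}
      (ℕP.+-cancelʳ-≡ (N * k) _ _ (trans (sym (lhs q₁ k N)) (trans double-count (rhs q₁ k N))))

  -- K = q₁ μ + 1 > 2 μ when q₁ ≥ 3, so q K + q μ exceeds three times q μ.
  positive-remainder : ∀ q₁ K μ Y → 3 ≤ q₁ → q₁ * μ + 1 ≡ K →
    suc q₁ * K + suc q₁ * μ ≤ (suc q₁ * μ + (suc q₁ * μ + suc q₁ * μ)) + Y → 0 < Y
  positive-remainder q₁ K μ (suc Y) _ _ _ = s≤s z≤n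
  positive-remainder q₁ K μ zero 3≤q₁ hμ covered = ⊥-elim (ℕP.<-irrefl refl (ℕP.<-≤-trans 3μ<K+μ K+μ≤3μ))
    where
    K+μ≤3μ : K + μ ≤ μ + (μ + μ)
    K+μ≤3μ = ℕP.*-cancelˡ-≤ (suc q₁) (subst₂ _≤_ (sym (ℕP.*-distribˡ-+ (suc q₁) K μ)) (regroup q₁ μ) covered)
      where
      regroup : ∀ q₁ μ → suc q₁ * μ + (suc q₁ * μ + suc q₁ * μ) + 0 ≡ suc q₁ * (μ + (μ + μ))
      regroup = solve-∀
    3μ<K+μ : μ + (μ + μ) < K + μ
    3μ<K+μ = ℕP.<-≤-trans (subst₂ _<_ (three μ) (trans (ℕP.+-comm 1 (q₁ * μ)) hμ) (s≤s (ℕP.*-monoˡ-≤ μ 3≤q₁)))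
                          (ℕP.m≤m+n K μ)
      where
      three : ∀ μ → 3 * μ ≡ μ + (μ + μ)
      three = solve-∀

  weight≡ : ∀ W Q M → W + (M + M) ≡ (Q + M) + (Q + M) → W ≡ 2 * Q
  weight≡ W Q M h = ℕP.+-cancelʳ-≡ (M + M) _ _ (trans h (regroup Q M))
    where
    regroup : ∀ Q M → (Q + M) + (Q + M) ≡ 2 * Q + (M + M)
    regroup = solve-∀

open Arithmetic

module TwoSubsetEnumeration where
  open import Data.Nat using (_+_; _<_)
  open import Data.Nat.Combinatorics using (nC1≡n; nCk+nC[k+1]≡[n+1]C[k+1]; k>n⇒nCk≡0)
  open import Data.Fin using (fromℕ; inject₁; splitAt; join)
  open import Data.Sum using (_⊎_)

  DecreasingPairs : ℕ → ℕ → Set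
  DecreasingPairs k N = Σ (Fin N → Fin k × Fin k) λ pr →
    (∀ w → toℕ (proj₂ (pr w)) < toℕ (proj₁ (pr w))) × (∀ w w′ → pr w ≡ pr w′ → w ≡ w′)

  -- The pairs of Fin (suc k) are the k pairs (k, i) followed by the pairs of Fin k.
  extendDecreasingPairs : ∀ k N → DecreasingPairs k N → DecreasingPairs (suc k) (k + N)
  extendDecreasingPairs k N (pr , decreasing , injective) = pr′ ∘ splitAt k , decreasing′ ∘ splitAt k , injective′
    where
    pr′ : Fin k ⊎ Fin N → Fin (suc k) × Fin (suc k)
    pr′ (inj₁ i) = fromℕ k , inject₁ i
    pr′ (inj₂ w) = inject₁ (proj₁ (pr w)) , inject₁ (proj₂ (pr w))
    decreasing′ : ∀ s → toℕ (proj₂ (pr′ s)) < toℕ (proj₁ (pr′ s))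
    decreasing′ (inj₁ i) = subst₂ _<_ (sym (FinP.toℕ-inject₁ i)) (sym (FinP.toℕ-fromℕ k)) (FinP.toℕ<n i)
    decreasing′ (inj₂ w) = subst₂ _<_ (sym (FinP.toℕ-inject₁ _)) (sym (FinP.toℕ-inject₁ _)) (decreasing w)
    top≢inject₁ : ∀ (i : Fin k) → fromℕ k ≢ inject₁ i
    top≢inject₁ i k≡i = FinP.toℕ-inject₁-≢ i (trans (sym (FinP.toℕ-fromℕ k)) (cong toℕ k≡i))
    pr′-injective : ∀ s s′ → pr′ s ≡ pr′ s′ → s ≡ s′
    pr′-injective (inj₁ i) (inj₁ i′) eq = cong inj₁ (FinP.inject₁-injective (cong proj₂ eq))
    pr′-injective (inj₁ i) (inj₂ w′) eq = ⊥-elim (top≢inject₁ _ (cong proj₁ eq))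
    pr′-injective (inj₂ w) (inj₁ i′) eq = ⊥-elim (top≢inject₁ _ (cong proj₁ (sym eq)))
    pr′-injective (inj₂ w) (inj₂ w′) eq = cong inj₂ (injective w w′
      (cong₂ _,_ (FinP.inject₁-injective (cong proj₁ eq)) (FinP.inject₁-injective (cong proj₂ eq))))
    injective′ : ∀ w w′ → pr′ (splitAt k w) ≡ pr′ (splitAt k w′) → w ≡ w′
    injective′ w w′ eq = trans (sym (FinP.join-splitAt k N w))
      (trans (cong (join k N) (pr′-injective _ _ eq)) (FinP.join-splitAt k N w′))

  decreasingPairs : ∀ k → DecreasingPairs k (k C 2)
  decreasingPairs zero    = subst (DecreasingPairs zero) (sym (k>n⇒nCk≡0 {0} {2} (s≤s z≤n))) ((λ ()) , (λ ()) , (λ ()))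
  decreasingPairs (suc k) = subst (DecreasingPairs (suc k)) Pascal (extendDecreasingPairs k (k C 2) (decreasingPairs k))
    where
    Pascal : k + k C 2 ≡ suc k C 2
    Pascal = trans (cong (_+ k C 2) (sym (nC1≡n k))) (nCk+nC[k+1]≡[n+1]C[k+1] k 1)

  -- The 2-subsets {fst w, snd w} of S, each listed once in a fixed orientation.
  record TwoSubsets {v} (S : Fin v → Bool) (N : ℕ) : Set where
    field
      fst snd   : Fin N → Fin v
      fst∈S     : ∀ w → S (fst w) ≡ true
      snd∈S     : ∀ w → S (snd w) ≡ true
      fst≢snd   : ∀ w → fst w ≢ snd w
      unflipped : ∀ w w′ → fst w ≡ snd w′ → snd w ≡ fst w′ → ⊥
      injective : ∀ w w′ → fst w ≡ fst w′ → snd w ≡ snd w′ → w ≡ w′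

  twoSubsets : ∀ {v} (S : Fin v → Bool) → TwoSubsets S (count S C 2)
  twoSubsets S = record
    { fst       = e ∘ i
    ; snd       = e ∘ j
    ; fst∈S     = e∈S ∘ i
    ; snd∈S     = e∈S ∘ j
    ; fst≢snd   = λ w ei≡ej → ℕP.<⇒≢ (decreasing w) (cong toℕ (sym (e-injective _ _ ei≡ej)))
    ; unflipped = λ w w′ iw≡jw′ jw≡iw′ → ℕP.<-asym (decreasing w)
                    (subst₂ (λ s t → toℕ s < toℕ t) (sym (e-injective _ _ iw≡jw′)) (sym (e-injective _ _ jw≡iw′)) (decreasing w′))
    ; injective = λ w w′ iw≡iw′ jw≡jw′ →
                    pr-injective w w′ (cong₂ _,_ (e-injective _ _ iw≡iw′) (e-injective _ _ jw≡jw′))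
    }
    where
    e = proj₁ (enumerate S)
    e∈S = proj₁ (proj₂ (enumerate S))
    e-injective = proj₂ (proj₂ (enumerate S))
    pr = proj₁ (decreasingPairs (count S))
    decreasing = proj₁ (proj₂ (decreasingPairs (count S)))
    pr-injective = proj₂ (proj₂ (decreasingPairs (count S)))
    i j : Fin (count S C 2) → Fin (count S)
    i = proj₁ ∘ pr
    j = proj₂ ∘ pr

open TwoSubsetEnumeration

module Codewords {v b} (D : Design v b) (β : Fin b) where
  open import Data.Integer using (ℤ; 0ℤ; 1ℤ; _*_)
  import Data.Integer.Properties as ℤP

  incidence-∈ : ∀ {z j} → D j z ≡ true → incidence D z j ≡ 1ℤ
  incidence-∈ z∈Bj rewrite z∈Bj = refl

  incidence-∉ : ∀ {z j} → D j z ≡ false → incidence D z j ≡ 0ℤ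
  incidence-∉ z∉Bj rewrite z∉Bj = refl

  pointCombination : ∀ {r} → (Fin r → Fin v) → (Fin r → ℤ) → Fin v → ℤ
  pointCombination sel α z = sumℤ (λ i → if ⌊ sel i Fin.≟ z ⌋ then α i else 0ℤ)

  codeword-*ˡ : ∀ (c : ℤ) (a : Fin v → ℤ) j → codeword D β (λ z → c * a z) j ≡ c * codeword D β a j
  codeword-*ˡ c a j = trans (sumℤ-cong termwise) (sumℤ-distribˡ c (λ z → if D β z then 0ℤ else a z * incidence D z j))
    where
    termwise : ∀ z → (if D β z then 0ℤ else c * a z * incidence D z j) ≡ c * (if D β z then 0ℤ else a z * incidence D z j)
    termwise z with D β z
    ... | true  = sym (ℤP.*-zeroʳ c)
    ... | false = ℤP.*-assoc c (a z) (incidence D z j)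

  codeword-pointCombination : ∀ {r} (sel : Fin r → Fin v) → (∀ i → D β (sel i) ≡ false) → (α : Fin r → ℤ) → ∀ j →
    codeword D β (pointCombination sel α) j ≡ sumℤ (λ i → α i * incidence D (sel i) j)
  codeword-pointCombination {r} sel sel∉B α j = begin
    codeword D β (pointCombination sel α) j                      ≡⟨ sumℤ-cong termwise ⟩
    sumℤ (λ z → sumℤ (λ i → term i z))                           ≡⟨ sumℤ-comm (λ z i → term i z) ⟩
    sumℤ (λ i → sumℤ (λ z → term i z))                           ≡⟨ sumℤ-cong (λ i → sumℤ-δ (sel i) (α i * incidence D (sel i) j)) ⟩
    sumℤ (λ i → α i * incidence D (sel i) j)                     ∎
    where
    open ≡-Reasoning
    term : Fin r → Fin v → ℤ
    term i z = if ⌊ sel i Fin.≟ z ⌋ then α i * incidence D (sel i) j else 0ℤ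
    term-∈B : ∀ i z → D β z ≡ true → term i z ≡ 0ℤ
    term-∈B i z z∈B with sel i Fin.≟ z
    ... | no  _    = refl
    ... | yes refl with trans (sym z∈B) (sel∉B i)
    ...   | ()
    term-∉B : ∀ i z → (if ⌊ sel i Fin.≟ z ⌋ then α i else 0ℤ) * incidence D z j ≡ term i z
    term-∉B i z with sel i Fin.≟ z
    ... | yes refl = refl
    ... | no  _    = ℤP.*-zeroˡ (incidence D z j)
    termwise : ∀ z → (if D β z then 0ℤ else pointCombination sel α z * incidence D z j) ≡ sumℤ (λ i → term i z)
    termwise z with D β z in z∈?B
    ... | true  = sym (trans (sumℤ-cong (λ i → term-∈B i z z∈?B)) (sumℤ-zero r))
    ... | false = trans (sym (sumℤ-distribʳ (incidence D z j) (λ i → if ⌊ sel i Fin.≟ z ⌋ then α i else 0ℤ)))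
                        (sumℤ-cong (λ i → term-∉B i z))

module ModularArithmetic (p : ℕ) (p-prime : Prime p) where
  open import Data.Nat using (_<_)
  open import Data.Nat.Primality using (prime⇒nonTrivial; euclidsLemma)
  import Data.Nat.Divisibility as ℕ∣
  open import Data.Integer using (ℤ; +_; -_; 0ℤ; 1ℤ; _+_; _-_; _*_; ∣_∣; _⊖_)
  import Data.Integer.Properties as ℤP
  open import Data.Integer.Divisibility.Signed
  open import Data.Integer.Tactic.RingSolver using (solve-∀)
  open import Relation.Binary.Definitions using (Tri; tri<; tri≈; tri>)

  1<p : 1 < p
  1<p = ℕ.nonTrivial⇒n>1 p {{prime⇒nonTrivial p-prime}}

  ∤-small : ∀ {d} → 0 < d → d < p → ¬ + p ∣ + d
  ∤-small 0<d d<p p∣d = ℕ∣.>⇒∤ {{ℕ.>-nonZero 0<d}} d<p (∣⇒∣ᵤ p∣d)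

  ∤1 : ¬ + p ∣ 1ℤ
  ∤1 = ∤-small (s≤s z≤n) 1<p

  ∤-* : ∀ {x y} → ¬ + p ∣ x → ¬ + p ∣ y → ¬ + p ∣ x * y
  ∤-* {x} {y} p∤x p∤y p∣xy
    with euclidsLemma ∣ x ∣ ∣ y ∣ p-prime (subst (p ℕ∣.∣_) (ℤP.abs-* x y) (∣⇒∣ᵤ p∣xy))
  ... | inj₁ p∣x = p∤x (∣ᵤ⇒∣ p∣x)
  ... | inj₂ p∣y = p∤y (∣ᵤ⇒∣ p∣y)

  ∤-neg : ∀ {x} → ¬ + p ∣ x → ¬ + p ∣ - x
  ∤-neg {x} p∤x p∣-x = p∤x (subst (+ p ∣_) (ℤP.neg-involutive x) (∣m⇒∣-m p∣-x))

  ∤-distinct : ∀ {a b} → a < p → b < p → a ≢ b → ¬ + p ∣ + a - + b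
  ∤-distinct {a} {b} a<p b<p a≢b p∣a-b = p∤∣a⊖b∣ (ℕP.<-cmp a b)
    where
    p∣∣a⊖b∣ : p ℕ∣.∣ ∣ a ⊖ b ∣
    p∣∣a⊖b∣ = subst (λ t → p ℕ∣.∣ ∣ t ∣) (ℤP.m-n≡m⊖n a b) (∣⇒∣ᵤ p∣a-b)
    p∤∣a⊖b∣ : Tri (a < b) (a ≡ b) (b < a) → ⊥
    p∤∣a⊖b∣ (tri≈ _ a≡b _) = a≢b a≡b
    p∤∣a⊖b∣ (tri< a<b _ _) = ∤-small (ℕP.m<n⇒0<n∸m a<b) (ℕP.≤-<-trans (ℕP.m∸n≤m b a) b<p)
      (∣ᵤ⇒∣ (subst (p ℕ∣.∣_) (ℤP.∣⊖∣-< a<b) p∣∣a⊖b∣))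
    p∤∣a⊖b∣ (tri> _ _ b<a) = ∤-small (ℕP.m<n⇒0<n∸m b<a) (ℕP.≤-<-trans (ℕP.m∸n≤m a b) a<p)
      (∣ᵤ⇒∣ (subst (p ℕ∣.∣_) (trans (ℤP.∣m⊖n∣≡∣n⊖m∣ a b) (ℤP.∣⊖∣-< b<a)) p∣∣a⊖b∣))

  ∣0 : + p ∣ 0ℤ
  ∣0 = divides 0ℤ refl

  ∣-sumℤ : ∀ {n} {f : Fin n → ℤ} → (∀ i → + p ∣ f i) → + p ∣ sumℤ f
  ∣-sumℤ {zero}  p∣f = ∣0
  ∣-sumℤ {suc n} p∣f = ∣m∣n⇒∣m+n (p∣f Fin.zero) (∣-sumℤ (p∣f ∘ Fin.suc))

  ∣-sumℤ-cong : ∀ {n} {f g : Fin n → ℤ} → (∀ i → + p ∣ f i - g i) → + p ∣ sumℤ f - sumℤ g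
  ∣-sumℤ-cong {zero}  p∣f-g = ∣0
  ∣-sumℤ-cong {suc n} {f} {g} p∣f-g =
    subst (+ p ∣_) (regroup (f Fin.zero) (g Fin.zero) (sumℤ (f ∘ Fin.suc)) (sumℤ (g ∘ Fin.suc)))
          (∣m∣n⇒∣m+n (p∣f-g Fin.zero) (∣-sumℤ-cong (p∣f-g ∘ Fin.suc)))
    where
    regroup : ∀ a b s t → a - b + (s - t) ≡ a + s - (b + t)
    regroup = solve-∀

  ∣-by-difference : ∀ {x} y → + p ∣ x - y → + p ∣ y → + p ∣ x
  ∣-by-difference {x} y p∣x-y p∣y = subst (+ p ∣_) (x-y+y≡x x y) (∣m∣n⇒∣m+n p∣x-y p∣y)
    where
    x-y+y≡x : ∀ x y → x - y + y ≡ x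
    x-y+y≡x = solve-∀

  ∤-by-difference : ∀ {x} y → + p ∣ x - y → ¬ + p ∣ y → ¬ + p ∣ x
  ∤-by-difference {x} y p∣x-y p∤y p∣x = p∤y (subst (+ p ∣_) (x-[x-y]≡y x y) (∣m∣n⇒∣m-n p∣x p∣x-y))
    where
    x-[x-y]≡y : ∀ x y → x - (x - y) ≡ y
    x-[x-y]≡y = solve-∀

  ≡[mod]⇒∣- : ∀ {x y} → x ≡ y [mod p ] → + p ∣ x - y
  ≡[mod]⇒∣- = ∣ᵤ⇒∣

  ∣-⇒≡[mod] : ∀ {x y} → + p ∣ x - y → x ≡ y [mod p ]
  ∣-⇒≡[mod] = ∣⇒∣ᵤ

  nonzeroᵇ-∣ : ∀ {x} → + p ∣ x → nonzeroᵇ p x ≡ false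
  nonzeroᵇ-∣ {x} p∣x with p ℕ∣.∣? ∣ x ∣
  ... | yes _   = refl
  ... | no  p∤x = ⊥-elim (p∤x (∣⇒∣ᵤ p∣x))

  nonzeroᵇ-∤ : ∀ {x} → ¬ + p ∣ x → nonzeroᵇ p x ≡ true
  nonzeroᵇ-∤ {x} p∤x with p ℕ∣.∣? ∣ x ∣
  ... | yes p∣x = ⊥-elim (p∤x (∣ᵤ⇒∣ p∣x))
  ... | no  _   = refl

  nonzeroᵇ-cong : ∀ {x y} → + p ∣ x - y → nonzeroᵇ p x ≡ nonzeroᵇ p y
  nonzeroᵇ-cong {x} {y} p∣x-y with + p ∣? y
  ... | yes p∣y = trans (nonzeroᵇ-∣ {x} (∣-by-difference y p∣x-y p∣y)) (sym (nonzeroᵇ-∣ p∣y))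
  ... | no  p∤y = trans (nonzeroᵇ-∤ {x} (∤-by-difference y p∣x-y p∤y)) (sym (nonzeroᵇ-∤ p∤y))

  ∣⇒≡0[mod] : ∀ {x} → + p ∣ x → x ≡ + 0 [mod p ]
  ∣⇒≡0[mod] {x} p∣x = ∣-⇒≡[mod] {x} {+ 0} (subst (+ p ∣_) (sym (ℤP.+-identityʳ x)) p∣x)

  ≡0[mod]⇒∣ : ∀ {x} → x ≡ + 0 [mod p ] → + p ∣ x
  ≡0[mod]⇒∣ {x} x≡0 = subst (+ p ∣_) (ℤP.+-identityʳ x) (≡[mod]⇒∣- {x} {+ 0} x≡0)

module LinearDependence (p : ℕ) (p-prime : Prime p) where
  open import Data.Nat using (_<_)
  open import Data.Integer using (ℤ; +_; -_; 0ℤ; 1ℤ; _+_; _-_; _*_)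
  import Data.Integer.Properties as ℤP
  open import Data.Integer.Divisibility.Signed using (_∣_; _∣?_; ∣n⇒∣m*n; ∣m⇒∣m*n)
  open import Data.Integer.Tactic.RingSolver using (solve-∀)
  open ModularArithmetic p p-prime

  lincomb : ∀ {K m} → (Fin K → ℤ) → (Fin K → Fin m → ℤ) → Fin m → ℤ
  lincomb γ u l = sumℤ (λ i → γ i * u i l)

  record LinearRelation {K m} (u : Fin K → Fin m → ℤ) : Set where
    field
      coeff      : Fin K → ℤ
      nontrivial : ∃[ i ] ¬ + p ∣ coeff i
      vanishes   : ∀ l → + p ∣ lincomb coeff u l

  lincomb-insertAt : ∀ {K m} (γ : Fin K → ℤ) (k : Fin (suc K)) (c : ℤ) (u : Fin (suc K) → Fin m → ℤ) l →
                     lincomb (insertAt γ k c) u l ≡ c * u k l + lincomb γ (u ∘ punchIn k) l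
  lincomb-insertAt γ k c u l =
    trans (sumℤ-remove (λ j → insertAt γ k c j * u j l) k)
          (cong₂ _+_ (cong (_* u k l) (insertAt-lookup γ k c))
                     (sumℤ-cong (λ i → cong (_* u (punchIn k i) l) (insertAt-punchIn γ k c i))))

  lincomb-assoc : ∀ {K s m} (γ : Fin K → ℤ) (u : Fin K → Fin s → ℤ) (N : Fin s → Fin m → ℤ) l →
                  lincomb γ (λ i → lincomb (u i) N) l ≡ lincomb (lincomb γ u) N l
  lincomb-assoc γ u N l = begin
    sumℤ (λ i → γ i * sumℤ (λ t → u i t * N t l))    ≡⟨ sumℤ-cong (λ i → sumℤ-distribˡ (γ i) (λ t → u i t * N t l)) ⟨
    sumℤ (λ i → sumℤ (λ t → γ i * (u i t * N t l)))  ≡⟨ sumℤ-comm (λ i t → γ i * (u i t * N t l)) ⟩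
    sumℤ (λ t → sumℤ (λ i → γ i * (u i t * N t l)))  ≡⟨ sumℤ-cong (λ t → sumℤ-cong (λ i → ℤP.*-assoc (γ i) (u i t) (N t l))) ⟨
    sumℤ (λ t → sumℤ (λ i → γ i * u i t * N t l))    ≡⟨ sumℤ-cong (λ t → sumℤ-distribʳ (N t l) (λ i → γ i * u i t)) ⟩
    sumℤ (λ t → lincomb γ u t * N t l)               ∎
    where open ≡-Reasoning

  lincomb-*ˡ : ∀ {K m} (c : ℤ) (γ : Fin K → ℤ) (u : Fin K → Fin m → ℤ) l →
               lincomb (λ i → c * γ i) u l ≡ c * lincomb γ u l
  lincomb-*ˡ c γ u l = trans (sumℤ-cong (λ i → ℤP.*-assoc c (γ i) (u i l))) (sumℤ-distribˡ c (λ i → γ i * u i l))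

  eliminate : ∀ {K m} → (Fin (suc K) → Fin (suc m) → ℤ) → Fin (suc K) → Fin K → Fin m → ℤ
  eliminate u k i l = u k Fin.zero * u (punchIn k i) (Fin.suc l) - u (punchIn k i) Fin.zero * u k (Fin.suc l)

  -- With the pivot d = u k 0, a relation β among the eliminated vectors lifts to the relation
  -- γ (punchIn k i) = d β i, γ k = - Σ β i u (punchIn k i) 0 among the u.
  liftedCoeff : ∀ {K m} → (Fin (suc K) → Fin (suc m) → ℤ) → Fin (suc K) → (Fin K → ℤ) → Fin (suc K) → ℤ
  liftedCoeff u k β = insertAt (λ i → u k Fin.zero * β i) k (- lincomb β (u ∘ punchIn k) Fin.zero)

  lincomb-liftedCoeff-zero : ∀ {K m} (u : Fin (suc K) → Fin (suc m) → ℤ) k β →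
                             lincomb (liftedCoeff u k β) u Fin.zero ≡ 0ℤ
  lincomb-liftedCoeff-zero u k β = begin
    lincomb (liftedCoeff u k β) u Fin.zero      ≡⟨ lincomb-insertAt (λ i → d * β i) k (- S) u Fin.zero ⟩
    - S * d + lincomb (λ i → d * β i) u′ Fin.zero ≡⟨ cong (λ t → - S * d + t) (lincomb-*ˡ d β u′ Fin.zero) ⟩
    - S * d + d * S                             ≡⟨ cancel S d ⟩
    0ℤ                                          ∎
    where
    open ≡-Reasoning
    u′ = u ∘ punchIn k
    d = u k Fin.zero
    S = lincomb β u′ Fin.zero
    cancel : ∀ S d → - S * d + d * S ≡ 0ℤ
    cancel = solve-∀

  lincomb-liftedCoeff-suc : ∀ {K m} (u : Fin (suc K) → Fin (suc m) → ℤ) k β l →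
                            lincomb (liftedCoeff u k β) u (Fin.suc l) ≡ lincomb β (eliminate u k) l
  lincomb-liftedCoeff-suc u k β l = begin
    lincomb (liftedCoeff u k β) u (Fin.suc l)     ≡⟨ lincomb-insertAt (λ i → d * β i) k (- S) u (Fin.suc l) ⟩
    - S * U + T                                   ≡⟨ swap S U T ⟩
    T + - U * S                                   ≡⟨ cong (λ t → T + t) (sumℤ-distribˡ (- U) (λ i → β i * u′ i Fin.zero)) ⟨
    T + sumℤ (λ i → - U * (β i * u′ i Fin.zero))  ≡⟨ sumℤ-distrib-+ (λ i → d * β i * u′ i (Fin.suc l)) _ ⟨
    sumℤ (λ i → d * β i * u′ i (Fin.suc l) + - U * (β i * u′ i Fin.zero))
                                                  ≡⟨ sumℤ-cong (λ i → regroup d (β i) (u′ i (Fin.suc l)) (u′ i Fin.zero) U) ⟩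
    lincomb β (eliminate u k) l                   ∎
    where
    open ≡-Reasoning
    u′ = u ∘ punchIn k
    d = u k Fin.zero
    S = lincomb β u′ Fin.zero
    U = u k (Fin.suc l)
    T = lincomb (λ i → d * β i) u′ (Fin.suc l)
    swap : ∀ S U T → - S * U + T ≡ T + - U * S
    swap = solve-∀
    regroup : ∀ d b a c U → d * b * a + - U * (b * c) ≡ b * (d * a - c * U)
    regroup = solve-∀

  liftRelation : ∀ {K m} (u : Fin (suc K) → Fin (suc m) → ℤ) (k : Fin (suc K)) →
                 ¬ + p ∣ u k Fin.zero → LinearRelation (eliminate u k) → LinearRelation u
  liftRelation u k p∤d record { coeff = β ; nontrivial = (i₀ , p∤βi₀) ; vanishes = β-vanishes } = record
    { coeff      = liftedCoeff u k β
    ; nontrivial = punchIn k i₀ , subst (λ t → ¬ + p ∣ t) (sym (insertAt-punchIn _ k _ i₀)) (∤-* p∤d p∤βi₀)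
    ; vanishes   = λ { Fin.zero    → subst (+ p ∣_) (sym (lincomb-liftedCoeff-zero u k β)) ∣0
                     ; (Fin.suc l) → subst (+ p ∣_) (sym (lincomb-liftedCoeff-suc u k β l)) (β-vanishes l) }
    }

  linearRelation : ∀ {m K} → m < K → (u : Fin K → Fin m → ℤ) → LinearRelation u
  linearRelation {zero} {suc K} _ u = record
    { coeff = λ _ → 1ℤ ; nontrivial = Fin.zero , ∤1 ; vanishes = λ () }
  linearRelation {suc m} {suc K} (s≤s m<K) u with FinP.any? (λ k → ¬? (+ p ∣? u k Fin.zero))
  ... | yes (k , p∤ukzero) = liftRelation u k p∤ukzero (linearRelation m<K (eliminate u k))
  ... | no  no-pivot = record
    { coeff      = coeff
    ; nontrivial = nontrivial
    ; vanishes   = λ { Fin.zero → ∣-sumℤ (λ i → ∣n⇒∣m*n (coeff i) (pivot-free i))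
                     ; (Fin.suc l) → vanishes l }
    }
    where
    open LinearRelation (linearRelation (ℕP.m≤n⇒m≤1+n m<K) (λ i l → u i (Fin.suc l)))
    pivot-free : ∀ i → + p ∣ u i Fin.zero
    pivot-free i with + p ∣? u i Fin.zero
    ... | yes p∣uizero = p∣uizero
    ... | no  p∤uizero = ⊥-elim (no-pivot (i , p∤uizero))

  relationAmongSpanned : ∀ {R C s K} (M : Fin R → Fin C → ℤ) (sel : Fin s → Fin R) →
    (∀ x → Σ (Fin s → ℤ) λ a → ∀ col → + p ∣ M x col - lincomb a (M ∘ sel) col) →
    s < K → (pt : Fin K → Fin R) → LinearRelation (M ∘ pt)
  relationAmongSpanned {s = s} {K} M sel span s<K pt = record
    { coeff = γ ; nontrivial = nontrivial ; vanishes = vanishes }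
    where
    u : Fin K → Fin s → ℤ
    u i = proj₁ (span (pt i))
    open LinearRelation (linearRelation s<K u) renaming (coeff to γ; vanishes to γu-vanishes)
    vanishes : ∀ col → + p ∣ lincomb γ (M ∘ pt) col
    vanishes col =
      ∣-by-difference (lincomb γ (λ i → lincomb (u i) (M ∘ sel)) col)
        (∣-sumℤ-cong (λ i → subst (+ p ∣_) (*-distribˡ-- (γ i) _ _) (∣n⇒∣m*n (γ i) (proj₂ (span (pt i)) col))))
        (subst (+ p ∣_) (sym (lincomb-assoc γ u (M ∘ sel) col))
               (∣-sumℤ (λ t → ∣m⇒∣m*n (M (sel t) col) (γu-vanishes t))))
      where
      *-distribˡ-- : ∀ a x y → a * (x - y) ≡ a * x - a * y
      *-distribˡ-- = solve-∀

module ResidualCode (p : ℕ) (p-prime : Prime p) {v b} (D : Design v b) (β : Fin b) where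
  open import Data.Integer using (ℤ; +_; -_; 0ℤ; 1ℤ; -1ℤ; _+_; _-_; _*_)
  import Data.Integer.Properties as ℤP
  open import Data.Integer.Divisibility.Signed using (_∣_; ∣m∣n⇒∣m+n; ∣m+n∣m⇒∣n; ∣n⇒∣m*n; ∣m⇒∣m*n)
  open import Data.Integer.Tactic.RingSolver using (solve-∀)
  open ModularArithmetic p p-prime
  open LinearDependence p p-prime
  open Codewords D β

  scaledDifference : ℤ → Fin v → Fin v → Fin b → ℤ
  scaledDifference G x y j = G * (incidence D x j - incidence D y j)

  RealisesDifference : (Fin v → ℤ) → ℤ → Fin v → Fin v → Set
  RealisesDifference a G x y = ∀ j → + p ∣ codeword D β a j - scaledDifference G x y j

  scaledDifference-∈∉ : ∀ G {x y j} → D j x ≡ true → D j y ≡ false → scaledDifference G x y j ≡ G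
  scaledDifference-∈∉ G x∈Bj y∉Bj rewrite incidence-∈ x∈Bj | incidence-∉ y∉Bj = ℤP.*-identityʳ G

  scaledDifference-∉∈ : ∀ G {x y j} → D j x ≡ false → D j y ≡ true → scaledDifference G x y j ≡ - G
  scaledDifference-∉∈ G x∉Bj y∈Bj rewrite incidence-∉ x∉Bj | incidence-∈ y∈Bj =
    trans (ℤP.*-comm G -1ℤ) (ℤP.-1*i≡-i G)

  scaledDifference-∉∉ : ∀ G {x y j} → D j x ≡ false → D j y ≡ false → scaledDifference G x y j ≡ 0ℤ
  scaledDifference-∉∉ G x∉Bj y∉Bj rewrite incidence-∉ x∉Bj | incidence-∉ y∉Bj = ℤP.*-zeroʳ G

  scaledDifference-∈∈ : ∀ G {x y j} → D j x ≡ true → D j y ≡ true → scaledDifference G x y j ≡ 0ℤ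
  scaledDifference-∈∈ G x∈Bj y∈Bj rewrite incidence-∈ x∈Bj | incidence-∈ y∈Bj = ℤP.*-zeroʳ G

  nonzeroᵇ-scaledDifference : ∀ {G} → ¬ + p ∣ G → ∀ x y j → nonzeroᵇ p (scaledDifference G x y j) ≡ D j x xor D j y
  nonzeroᵇ-scaledDifference {G} p∤G x y j = by-membership (D j x) (D j y) refl refl
    where
    S = scaledDifference G x y j
    by-membership : ∀ bx by → D j x ≡ bx → D j y ≡ by → nonzeroᵇ p S ≡ bx xor by
    by-membership true  true  x∈Bj y∈Bj = nonzeroᵇ-∣ {S} (subst (+ p ∣_) (sym (scaledDifference-∈∈ G x∈Bj y∈Bj)) ∣0)
    by-membership true  false x∈Bj y∉Bj = nonzeroᵇ-∤ {S} (subst (λ t → ¬ + p ∣ t) (sym (scaledDifference-∈∉ G x∈Bj y∉Bj)) p∤G)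
    by-membership false true  x∉Bj y∈Bj = nonzeroᵇ-∤ {S} (subst (λ t → ¬ + p ∣ t) (sym (scaledDifference-∉∈ G x∉Bj y∈Bj)) (∤-neg p∤G))
    by-membership false false x∉Bj y∉Bj = nonzeroᵇ-∣ {S} (subst (+ p ∣_) (sym (scaledDifference-∉∉ G x∉Bj y∉Bj)) ∣0)

  nonzeroᵇ-realised : ∀ {a G x y} → RealisesDifference a G x y → ¬ + p ∣ G → ∀ j →
                      nonzeroᵇ p (codeword D β a j) ≡ D j x xor D j y
  nonzeroᵇ-realised {a} {G} {x} {y} realises p∤G j =
    trans (nonzeroᵇ-cong {codeword D β a j} {scaledDifference G x y j} (realises j)) (nonzeroᵇ-scaledDifference p∤G x y j)

  realises-*ˡ : ∀ c {a G x y} → RealisesDifference a G x y → RealisesDifference (λ z → c * a z) (c * G) x y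
  realises-*ˡ c {a} {G} {x} {y} realises j = subst (+ p ∣_) (sym factor) (∣n⇒∣m*n c (realises j))
    where
    regroup : ∀ c w G d → c * w - c * G * d ≡ c * (w - G * d)
    regroup = solve-∀
    factor : codeword D β (λ z → c * a z) j - c * G * (incidence D x j - incidence D y j)
             ≡ c * (codeword D β a j - scaledDifference G x y j)
    factor = trans (cong (λ t → t - c * G * (incidence D x j - incidence D y j)) (codeword-*ˡ c a j))
                   (regroup c (codeword D β a j) G (incidence D x j - incidence D y j))

  lincomb-outside-B : ∀ {r} (sel : Fin r → Fin v) → (∀ i → D β (sel i) ≡ false) → ∀ γ →
                      lincomb γ (incidence D ∘ sel) β ≡ 0ℤ
  lincomb-outside-B {r} sel sel∉B γ =
    trans (sumℤ-cong (λ i → trans (cong (γ i *_) (incidence-∉ (sel∉B i))) (ℤP.*-zeroʳ (γ i)))) (sumℤ-zero r)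

  -- Column β shows that the coefficients of x and y in the relation are opposite, and
  -- independence of the residual rows that they are nonzero.
  difference-from-relation : ∀ {r x y} (sel : Fin r → Fin v) →
    D β x ≡ true → D β y ≡ true → (∀ i → D β (sel i) ≡ false) →
    (∀ (a : Fin r → ℤ) → (∀ col → neqᵇ col β ≡ true → + p ∣ lincomb a (incidence D ∘ sel) col) → ∀ i → + p ∣ a i) →
    LinearRelation (incidence D ∘ (x ∷ y ∷ sel)) →
    Σ (Fin v → ℤ) λ a → Σ ℤ λ G → ¬ + p ∣ G × RealisesDifference a G x y
  difference-from-relation {r} {x} {y} sel x∈B y∈B sel∉B independent
    record { coeff = γ ; nontrivial = (i₀ , p∤γi₀) ; vanishes = vanishes } =
    pointCombination sel α , γx , p∤γx , realises
    where
    A = incidence D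
    γx = γ Fin.zero
    γy = γ (Fin.suc Fin.zero)
    γ₂ : Fin r → ℤ
    γ₂ i = γ (Fin.suc (Fin.suc i))
    L : Fin b → ℤ
    L = lincomb γ₂ (A ∘ sel)
    α : Fin r → ℤ
    α i = -1ℤ * γ₂ i

    p∣γx+γy : + p ∣ γx + γy
    p∣γx+γy = subst (+ p ∣_) column-β (vanishes β)
      where
      simplify : ∀ a b → a * 1ℤ + (b * 1ℤ + 0ℤ) ≡ a + b
      simplify = solve-∀
      column-β : γx * A x β + (γy * A y β + L β) ≡ γx + γy
      column-β = trans (cong₂ (λ s t → γx * s + (γy * t + L β)) (incidence-∈ x∈B) (incidence-∈ y∈B))
                       (trans (cong (λ t → γx * 1ℤ + (γy * 1ℤ + t)) (lincomb-outside-B sel sel∉B γ₂)) (simplify γx γy))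

    p∤γx : ¬ + p ∣ γx
    p∤γx p∣γx = p∤γi₀ (p∣γ i₀)
      where
      p∣γy : + p ∣ γy
      p∣γy = ∣m+n∣m⇒∣n p∣γx+γy p∣γx
      p∣L : ∀ col → neqᵇ col β ≡ true → + p ∣ L col
      p∣L col _ = ∣m+n∣m⇒∣n (∣m+n∣m⇒∣n (vanishes col) (∣m⇒∣m*n (A x col) p∣γx)) (∣m⇒∣m*n (A y col) p∣γy)
      p∣γ : ∀ i → + p ∣ γ i
      p∣γ Fin.zero             = p∣γx
      p∣γ (Fin.suc Fin.zero)    = p∣γy
      p∣γ (Fin.suc (Fin.suc i)) = independent γ₂ p∣L i

    realises : RealisesDifference (pointCombination sel α) γx x y
    realises j = subst (+ p ∣_) (sym rearrange)
                   (∣m∣n⇒∣m+n (∣n⇒∣m*n -1ℤ (vanishes j)) (∣m⇒∣m*n (A y j) p∣γx+γy))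
      where
      regroup : ∀ gx gy ax ay l → -1ℤ * l - gx * (ax - ay) ≡ -1ℤ * (gx * ax + (gy * ay + l)) + (gx + gy) * ay
      regroup = solve-∀
      rearrange : codeword D β (pointCombination sel α) j - γx * (A x j - A y j)
                  ≡ -1ℤ * (γx * A x j + (γy * A y j + L j)) + (γx + γy) * A y j
      rearrange = trans (cong (λ t → t - γx * (A x j - A y j))
                              (trans (codeword-pointCombination sel sel∉B α j) (lincomb-*ˡ -1ℤ γ₂ (A ∘ sel) j)))
                        (regroup γx γy (A x j) (A y j) (L j))

  -- Rank r + 1 forces a linear relation among the r + 2 rows x, y and sel₂.
  difference-in-residualCode : LinearlyEmbeddable p D β → ∀ {x y} → D β x ≡ true → D β y ≡ true →
    Σ (Fin v → ℤ) λ a → Σ ℤ λ G → ¬ + p ∣ G × RealisesDifference a G x y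
  difference-in-residualCode (r , (sel₁ , _ , _ , span₁) , (sel₂ , sel₂-residual , independent₂ , _)) {x} {y} x∈B y∈B =
    difference-from-relation sel₂ x∈B y∈B sel₂∉B independent
      (relationAmongSpanned (incidence D) sel₁ spanned ℕP.≤-refl (x ∷ y ∷ sel₂))
    where
    spanned : ∀ z → Σ (Fin (suc r) → ℤ) λ c → ∀ col → + p ∣ incidence D z col - lincomb c (incidence D ∘ sel₁) col
    spanned z = c , λ col → ≡[mod]⇒∣- {incidence D z col} {lincomb c (incidence D ∘ sel₁) col} (proj₂ (span₁ z refl) col refl)
      where c = proj₁ (span₁ z refl)
    sel₂∉B : ∀ i → D β (sel₂ i) ≡ false
    sel₂∉B i = trans (sym (BoolP.not-involutive (D β (sel₂ i)))) (cong not (sel₂-residual i))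
    independent : ∀ (a : Fin r → ℤ) → (∀ col → neqᵇ col β ≡ true → + p ∣ lincomb a (incidence D ∘ sel₂) col) →
                  ∀ i → + p ∣ a i
    independent a p∣a·sel₂ i = ≡0[mod]⇒∣ (independent₂ a (λ col col≢β → ∣⇒≡0[mod] (p∣a·sel₂ col col≢β)) i)

-- q = q₁ + 1 and n = m + 2: blocks have k = q^(n-1) points, blocks of S have K = q^(n-2), and
-- lam, μ are the λ of D and of S.
module AffineDesign
  (q₁ m : ℕ) (3≤q₁ : 3 ℕ.≤ q₁) {b} (D : Design (suc q₁ ℕ.^ suc (suc m)) b) (β : Fin b)
  (block-size : ∀ j → count (D j) ≡ suc q₁ ℕ.^ suc m)
  (r : ℕ) (replication : ∀ x → count (λ j → D j x) ≡ r) (b≡v+r∸1 : b ≡ suc q₁ ℕ.^ suc (suc m) ℕ.+ r ℕ.∸ 1)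
  (lam : ℕ) (hλ : q₁ ℕ.* lam ≡ suc q₁ ℕ.^ suc m ℕ.∸ 1)
  (μ : ℕ) (hμ : q₁ ℕ.* μ ≡ suc q₁ ℕ.^ m ℕ.∸ 1)
  {s} (T : Fin s → FSet (suc q₁ ℕ.^ suc (suc m))) (T-size : ∀ i → count (T i) ≡ suc q₁ ℕ.^ m)
  (pair-count : ∀ x y → x ≢ y → D β x ≡ true → D β y ≡ true →
                count (λ j → neqᵇ j β ∧ (D j x ∧ D j y)) ≡ suc q₁ ℕ.* μ)
  (meets : ∀ j → j ≢ β → Nonempty (D β ∩ D j) → ∃[ i ] SameSet (D β ∩ D j) (T i))
  where

  q K k : ℕ
  q = suc q₁
  K = q ℕ.^ m
  k = q ℕ.* K

  inD'' : Fin b → Bool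
  inD'' = inD''ᵇ q (suc (suc m)) D β

  module Combinatorics where
    open import Data.Nat using (_+_; _*_; _∸_; _≤_; _<_)

    0<q₁ : 0 < q₁
    0<q₁ = ℕP.<-≤-trans (s≤s z≤n) 3≤q₁

    q₁μ+1≡K : q₁ * μ + 1 ≡ K
    q₁μ+1≡K = ≡∸1⇒+1≡ (ℕP.m^n>0 q m) hμ

    blocks-through : ∀ {x} → D β x ≡ true → count (λ j → neqᵇ j β ∧ D j x) ≡ q * K + q * μ
    blocks-through {x} x∈B = begin
      N               ≡⟨ other-blocks≡qλ q₁ lam N 0<q₁ double-count ⟩
      q * lam         ≡⟨ cong (q *_) (lam≡K+μ q₁ K μ lam 0<q₁ q₁μ+1≡K q₁λ+1≡k) ⟩
      q * (K + μ)     ≡⟨ ℕP.*-distribˡ-+ q K μ ⟩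
      q * K + q * μ   ∎
      where
      open ≡-Reasoning
      N = count (λ j → neqᵇ j β ∧ D j x)
      q₁λ+1≡k : q₁ * lam + 1 ≡ k
      q₁λ+1≡k = ≡∸1⇒+1≡ (ℕP.m^n>0 q (suc m)) hλ
      r≡1+N : r ≡ suc N
      r≡1+N = trans (sym (replication x)) (trans (count-remove (λ j → D j x) β) (cong (λ t → indicator t + N) x∈B))
      b≡v+N : b ≡ q * k + N
      b≡v+N = trans b≡v+r∸1 (trans (cong (λ t → q * k + t ∸ 1) r≡1+N) (cong (_∸ 1) (ℕP.+-suc (q * k) N)))
      double-count : (q * (q₁ * lam + 1) + N) * (q₁ * lam + 1) ≡ q * (q₁ * lam + 1) * suc N
      double-count rewrite q₁λ+1≡k | sym b≡v+N | sym r≡1+N = double-counting D block-size replication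

    meets⇒inD'' : ∀ {j z} → neqᵇ j β ≡ true → D j z ≡ true → D β z ≡ true → inD'' j ≡ true
    meets⇒inD'' {j} {z} j≢β z∈Bj z∈B = cong₂ _∧_ j≢β (Equivalence.to BoolP.T-≡ (ℕP.≡⇒≡ᵇ _ _ outside-B))
      where
      T-intersection = meets j (neqᵇ⇒≢ j≢β) (z , cong₂ _∧_ z∈B z∈Bj)
      inside-B : count (λ x → D j x ∧ D β x) ≡ K
      inside-B = trans (count-cong (λ x → trans (BoolP.∧-comm (D j x) (D β x)) (proj₂ T-intersection x)))
                       (T-size (proj₁ T-intersection))
      outside-B : count (D j ─ D β) ≡ k ∸ K
      outside-B = trans (sym (ℕP.m+n∸m≡n K (count (D j ─ D β))))
                        (cong (_∸ K) (trans (cong (_+ count (D j ─ D β)) (sym inside-B))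
                                            (trans (sym (count-split (D j) (D β))) (block-size j))))

    difference-weight : ∀ {x y} → x ≢ y → D β x ≡ true → D β y ≡ true →
      count (λ j → neqᵇ j β ∧ (D j x xor D j y)) ≡ 2 * k
    difference-weight {x} {y} x≢y x∈B y∈B = weight≡ W (q * K) (q * μ) (begin
      W + (q * μ + q * μ)                                   ≡⟨ cong (λ t → W + (t + t)) (pair-count x y x≢y x∈B y∈B) ⟨
      W + (P + P)                                           ≡⟨ count-xor (λ j → neqᵇ j β) (λ j → D j x) (λ j → D j y) ⟩
      count (λ j → neqᵇ j β ∧ D j x) + count (λ j → neqᵇ j β ∧ D j y)
                                                            ≡⟨ cong₂ _+_ (blocks-through x∈B) (blocks-through y∈B) ⟩
      (q * K + q * μ) + (q * K + q * μ)                     ∎)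
      where
      open ≡-Reasoning
      W = count (λ j → neqᵇ j β ∧ (D j x xor D j y))
      P = count (λ j → neqᵇ j β ∧ (D j x ∧ D j y))

    separating-block : ∀ {x y₁ y₂ y₃} → D β x ≡ true → D β y₁ ≡ true → D β y₂ ≡ true → D β y₃ ≡ true →
      x ≢ y₁ → x ≢ y₂ → x ≢ y₃ →
      ∃[ j ] (neqᵇ j β ≡ true × D j x ≡ true × D j y₁ ≡ false × D j y₂ ≡ false × D j y₃ ≡ false)
    separating-block {x} {y₁} {y₂} {y₃} x∈B y₁∈B y₂∈B y₃∈B x≢y₁ x≢y₂ x≢y₃ =
      let (j , separates) = count>0⇒∃ (λ j → f j ∧ not (g j))
                              (positive-remainder q₁ K μ (count (λ j → f j ∧ not (g j))) 3≤q₁ q₁μ+1≡K covered)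
      in j , decompose (neqᵇ j β) (D j x) (D j y₁) (D j y₂) (D j y₃) separates
      where
      f g : Fin b → Bool
      f j = neqᵇ j β ∧ D j x
      g j = D j y₁ ∨ (D j y₂ ∨ D j y₃)
      open ℕP.≤-Reasoning
      through-x-and : ∀ {y} → x ≢ y → D β y ≡ true → count (λ j → f j ∧ D j y) ≡ q * μ
      through-x-and {y} x≢y y∈B =
        trans (count-cong (λ j → BoolP.∧-assoc (neqᵇ j β) (D j x) (D j y))) (pair-count x y x≢y x∈B y∈B)
      covered : q * K + q * μ ≤ (q * μ + (q * μ + q * μ)) + count (λ j → f j ∧ not (g j))
      covered = begin
        q * K + q * μ                                                 ≡⟨ blocks-through x∈B ⟨
        count f                                                       ≡⟨ count-split f g ⟩
        count (λ j → f j ∧ g j) + count (λ j → f j ∧ not (g j))       ≤⟨ ℕP.+-monoˡ-≤ _ (begin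
          count (λ j → f j ∧ g j)                                       ≤⟨ count-∨-≤ f (λ j → D j y₁) (λ j → D j y₂ ∨ D j y₃) ⟩
          count (λ j → f j ∧ D j y₁) + count (λ j → f j ∧ (D j y₂ ∨ D j y₃))
                                                                        ≤⟨ ℕP.+-monoʳ-≤ _ (count-∨-≤ f (λ j → D j y₂) (λ j → D j y₃)) ⟩
          count (λ j → f j ∧ D j y₁) + (count (λ j → f j ∧ D j y₂) + count (λ j → f j ∧ D j y₃))
                                                                        ≡⟨ cong₂ (λ s t → s + t) (through-x-and x≢y₁ y₁∈B)
                                                                             (cong₂ _+_ (through-x-and x≢y₂ y₂∈B) (through-x-and x≢y₃ y₃∈B)) ⟩
          q * μ + (q * μ + q * μ)                                       ∎) ⟩
        (q * μ + (q * μ + q * μ)) + count (λ j → f j ∧ not (g j))     ∎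
      decompose : ∀ n a c d e → (n ∧ a) ∧ not (c ∨ (d ∨ e)) ≡ true →
                  n ≡ true × a ≡ true × c ≡ false × d ≡ false × e ≡ false
      decompose true  true  false false false _  = refl , refl , refl , refl , refl
      decompose false _     _     _     _     ()
      decompose true  false _     _     _     ()
      decompose true  true  true  _     _     ()
      decompose true  true  false true  _     ()
      decompose true  true  false false true  ()

  open Combinatorics

  module Codes (p : ℕ) (p-prime : Prime p) (embeddable : LinearlyEmbeddable p D β) where
    open import Data.Integer using (ℤ; +_; -_; _+_; _-_; _*_)
    import Data.Integer.Properties as ℤP
    open import Data.Integer.Divisibility.Signed using (_∣_; ∣m∣n⇒∣m+n; ∣m∣n⇒∣m-n)
    open import Data.Integer.Tactic.RingSolver using (solve-∀)
    open ModularArithmetic p p-prime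
    open ResidualCode p p-prime D β

    record PairCodeword : Set where
      field
        vec       : Fin (q ℕ.* k) → ℤ
        scale     : ℤ
        fst snd   : Fin (q ℕ.* k)
        fst∈B     : D β fst ≡ true
        snd∈B     : D β snd ≡ true
        fst≢snd   : fst ≢ snd
        p∤scale   : ¬ + p ∣ scale
        realises  : RealisesDifference vec scale fst snd

      nonzero-pattern : ∀ j → nonzeroᵇ p (codeword D β vec j) ≡ D j fst xor D j snd
      nonzero-pattern = nonzeroᵇ-realised {vec} realises p∤scale

    open PairCodeword

    weight : ∀ c → count (λ j → inD'' j ∧ nonzeroᵇ p (codeword D β (vec c) j)) ≡ 2 ℕ.* k
    weight c = trans (count-cong in-support) (difference-weight (fst≢snd c) (fst∈B c) (snd∈B c))
      where
      meets-pair : ∀ j → neqᵇ j β ≡ true → (D j (fst c) xor D j (snd c)) ≡ true → inD'' j ≡ true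
      meets-pair j j≢β with D j (fst c) in fst∈?Bj
      ... | true  = λ _ → meets⇒inD'' j≢β fst∈?Bj (fst∈B c)
      ... | false = λ snd∈Bj → meets⇒inD'' j≢β snd∈Bj (snd∈B c)
      restrict : ∀ n s c → (n ≡ true → c ≡ true → n ∧ s ≡ true) → (n ∧ s) ∧ c ≡ n ∧ c
      restrict false s c       _       = refl
      restrict true  s false   _       = BoolP.∧-zeroʳ s
      restrict true  s true    meets-c = trans (BoolP.∧-identityʳ s) (meets-c refl refl)
      in-support : ∀ j → inD'' j ∧ nonzeroᵇ p (codeword D β (vec c) j) ≡ neqᵇ j β ∧ (D j (fst c) xor D j (snd c))
      in-support j = trans (cong (inD'' j ∧_) (nonzero-pattern c j)) (restrict _ _ _ (meets-pair j))

    constant-on-classes : ∀ c {j j′} → SameSet (D β ∩ D j) (D β ∩ D j′) →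
      nonzeroᵇ p (codeword D β (vec c) j) ≡ nonzeroᵇ p (codeword D β (vec c) j′)
    constant-on-classes c {j} {j′} same-trace = begin
      nonzeroᵇ p (codeword D β (vec c) j)   ≡⟨ nonzero-pattern c j ⟩
      D j (fst c) xor D j (snd c)           ≡⟨ cong₂ _xor_ (agree (fst∈B c)) (agree (snd∈B c)) ⟩
      D j′ (fst c) xor D j′ (snd c)         ≡⟨ nonzero-pattern c j′ ⟨
      nonzeroᵇ p (codeword D β (vec c) j′)  ∎
      where
      open ≡-Reasoning
      agree : ∀ {z} → D β z ≡ true → D j z ≡ D j′ z
      agree {z} z∈B = subst (λ t → t ∧ D j z ≡ t ∧ D j′ z) z∈B (same-trace z)

    Distinguished : (Fin (q ℕ.* k) → ℤ) → (Fin (q ℕ.* k) → ℤ) → Set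
    Distinguished a a′ = ∃[ j ] (inD'' j ≡ true × ¬ (codeword D β a j ≡ codeword D β a′ j [mod p ]))

    differenceValue : PairCodeword → Fin b → ℤ
    differenceValue c = scaledDifference (scale c) (fst c) (snd c)

    distinguished-at : ∀ c c′ {j z d} → neqᵇ j β ≡ true → D j z ≡ true → D β z ≡ true →
      differenceValue c j - differenceValue c′ j ≡ d → ¬ + p ∣ d → Distinguished (vec c) (vec c′)
    distinguished-at c c′ {j} j≢β z∈Bj z∈B Δ≡d p∤d = j , meets⇒inD'' j≢β z∈Bj z∈B , λ same-mod-p →
      p∤d (subst (+ p ∣_) (trans (regroup w w′ (differenceValue c j) (differenceValue c′ j)) Δ≡d)
            (∣m∣n⇒∣m+n (∣m∣n⇒∣m-n (≡[mod]⇒∣- {w} {w′} same-mod-p) (realises c j)) (realises c′ j)))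
      where
      w = codeword D β (vec c) j
      w′ = codeword D β (vec c′) j
      regroup : ∀ w w′ s s′ → w - w′ - (w - s) + (w′ - s′) ≡ s - s′
      regroup = solve-∀

    distinguishable : ∀ c c′ → ¬ (fst c ≡ snd c′ × snd c ≡ fst c′) →
      (fst c ≡ fst c′ → snd c ≡ snd c′ → ¬ + p ∣ scale c - scale c′) → Distinguished (vec c) (vec c′)
    distinguishable c c′ unflipped scales-differ =
      by-cases (x Fin.≟ fst c′) (x Fin.≟ snd c′) (y Fin.≟ fst c′) (y Fin.≟ snd c′)
      where
      x = fst c
      y = snd c
      fst-outside : x ≢ fst c′ → x ≢ snd c′ → Distinguished (vec c) (vec c′)
      fst-outside x≢x′ x≢y′ =
        let (j , j≢β , x∈Bj , y∉Bj , x′∉Bj , y′∉Bj) =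
              separating-block (fst∈B c) (snd∈B c) (fst∈B c′) (snd∈B c′) (fst≢snd c) x≢x′ x≢y′
        in distinguished-at c c′ j≢β x∈Bj (fst∈B c)
             (trans (cong₂ _-_ (scaledDifference-∈∉ (scale c) x∈Bj y∉Bj) (scaledDifference-∉∉ (scale c′) x′∉Bj y′∉Bj))
                    (ℤP.+-identityʳ (scale c)))
             (p∤scale c)
      snd-outside : y ≢ fst c′ → y ≢ snd c′ → Distinguished (vec c) (vec c′)
      snd-outside y≢x′ y≢y′ =
        let (j , j≢β , y∈Bj , x∉Bj , x′∉Bj , y′∉Bj) =
              separating-block (snd∈B c) (fst∈B c) (fst∈B c′) (snd∈B c′) (fst≢snd c ∘ sym) y≢x′ y≢y′
        in distinguished-at c c′ j≢β y∈Bj (snd∈B c)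
             (trans (cong₂ _-_ (scaledDifference-∉∈ (scale c) x∉Bj y∈Bj) (scaledDifference-∉∉ (scale c′) x′∉Bj y′∉Bj))
                    (ℤP.+-identityʳ (- scale c)))
             (∤-neg (p∤scale c))
      same-pair : x ≡ fst c′ → y ≡ snd c′ → Distinguished (vec c) (vec c′)
      same-pair x≡x′ y≡y′ =
        let (j , j≢β , x∈Bj , y∉Bj , _) =
              separating-block (fst∈B c) (snd∈B c) (snd∈B c) (snd∈B c) (fst≢snd c) (fst≢snd c) (fst≢snd c)
        in distinguished-at c c′ j≢β x∈Bj (fst∈B c)
             (cong₂ _-_ (scaledDifference-∈∉ (scale c) x∈Bj y∉Bj)
                        (scaledDifference-∈∉ (scale c′) (subst (λ t → D j t ≡ true) x≡x′ x∈Bj)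
                                                             (subst (λ t → D j t ≡ false) y≡y′ y∉Bj)))
             (scales-differ x≡x′ y≡y′)
      by-cases : Dec (x ≡ fst c′) → Dec (x ≡ snd c′) → Dec (y ≡ fst c′) → Dec (y ≡ snd c′) → Distinguished (vec c) (vec c′)
      by-cases (no x≢x′)  (no x≢y′)  _          _          = fst-outside x≢x′ x≢y′
      by-cases _          _          (no y≢x′)  (no y≢y′)  = snd-outside y≢x′ y≢y′
      by-cases (yes x≡x′) _          _          (yes y≡y′) = same-pair x≡x′ y≡y′
      by-cases (yes x≡x′) _          (yes y≡x′) _          = ⊥-elim (fst≢snd c (trans x≡x′ (sym y≡x′)))
      by-cases _          (yes x≡y′) (yes y≡x′) _          = ⊥-elim (unflipped (x≡y′ , y≡x′))
      by-cases _          (yes x≡y′) _          (yes y≡y′) = ⊥-elim (fst≢snd c (trans x≡y′ (sym y≡y′)))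

    pairs : TwoSubsets (D β) (k C 2)
    pairs = subst (λ N → TwoSubsets (D β) (N C 2)) (block-size β) (twoSubsets (D β))

    module Pairs = TwoSubsets pairs

    scalePairCodeword : ∀ c → ¬ + p ∣ c → PairCodeword → PairCodeword
    scalePairCodeword c p∤c w = record w
      { vec      = λ z → c * vec w z
      ; scale    = c * scale w
      ; p∤scale  = ∤-* p∤c (p∤scale w)
      ; realises = realises-*ˡ c {vec w} {scale w} (realises w)
      }

    pairDifference : Fin (k C 2) → PairCodeword
    pairDifference w =
      let (a , G , p∤G , realises-G) = difference-in-residualCode embeddable (Pairs.fst∈S w) (Pairs.snd∈S w)
      in record
        { vec      = a
        ; scale    = G
        ; fst      = Pairs.fst w
        ; snd      = Pairs.snd w
        ; fst∈B    = Pairs.fst∈S w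
        ; snd∈B    = Pairs.snd∈S w
        ; fst≢snd  = Pairs.fst≢snd w
        ; p∤scale  = p∤G
        ; realises = realises-G
        }

    multiplier<p : ∀ (c : Fin (p ℕ.∸ 1)) → suc (toℕ c) ℕ.< p
    multiplier<p c = subst (suc (toℕ c) ℕ.<_) (trans (ℕP.+-comm 1 (p ℕ.∸ 1)) (ℕP.m∸n+n≡m (ℕP.<⇒≤ 1<p))) (s≤s (FinP.toℕ<n c))

    pairCodeword : Fin (p ℕ.∸ 1) → Fin (k C 2) → PairCodeword
    pairCodeword c w = scalePairCodeword (+ suc (toℕ c)) (∤-small (s≤s z≤n) (multiplier<p c)) (pairDifference w)

    pairCodewords-distinguished : ∀ {c w c′ w′} → (c , w) ≢ (c′ , w′) →
      Distinguished (vec (pairCodeword c w)) (vec (pairCodeword c′ w′))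
    pairCodewords-distinguished {c} {w} {c′} {w′} cw≢c′w′ =
      distinguishable (pairCodeword c w) (pairCodeword c′ w′)
        (λ (x≡y′ , y≡x′) → Pairs.unflipped w w′ x≡y′ y≡x′)
        (λ x≡x′ y≡y′ → scales-differ (Pairs.injective w w′ x≡x′ y≡y′))
      where
      factor : ∀ m m′ G → (m - m′) * G ≡ m * G - m′ * G
      factor = solve-∀
      scales-differ : w ≡ w′ → ¬ + p ∣ scale (pairCodeword c w) - scale (pairCodeword c′ w′)
      scales-differ refl = subst (λ t → ¬ + p ∣ t) (factor (+ suc (toℕ c)) (+ suc (toℕ c′)) (scale (pairDifference w)))
        (∤-* (∤-distinct (multiplier<p c) (multiplier<p c′) c≢c′) (p∤scale (pairDifference w)))
        where
        c≢c′ : suc (toℕ c) ≢ suc (toℕ c′)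
        c≢c′ eq = cw≢c′w′ (cong₂ _,_ (FinP.toℕ-injective (ℕP.suc-injective eq)) refl)

open import Data.Nat using (_*_; _∸_; _^_; _≤_)
open import Data.Integer using (ℤ)

theorem3p3 :
  (p t q n : ℕ) → Prime p → q ≡ p ^ t → 4 ≤ q → 2 ≤ n →
  (lam : ℕ) → (q ∸ 1) * lam ≡ q ^ (n ∸ 1) ∸ 1 →
  (b : ℕ) (D : Design (q ^ n) b) →
  AffineResolvable D (q ^ (n ∸ 1)) lam →
  (β : Fin b) → GoodBlock q n D β →
  LinearlyEmbeddable p D β →
  Σ (Fin ((p ∸ 1) * ((q ^ (n ∸ 1)) C 2)) → (Fin (q ^ n) → ℤ)) λ cw →
    -- each is a codeword of weight 2 q^(n-1)
    (∀ m → count (λ j → inD''ᵇ q n D β j ∧ nonzeroᵇ p (codeword D β (cw m) j))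
             ≡ 2 * q ^ (n ∸ 1)) ×
    -- its support is a union of parallel classes of R
    (∀ m j j' → inD''ᵇ q n D β j ≡ true → inD''ᵇ q n D β j' ≡ true →
       SameSet (D β ∩ D j) (D β ∩ D j') →
       nonzeroᵇ p (codeword D β (cw m) j) ≡ nonzeroᵇ p (codeword D β (cw m) j')) ×
    -- the codewords are pairwise distinct
    (∀ m m' → m ≢ m' →
       ∃[ j ] (inD''ᵇ q n D β j ≡ true ×
               ¬ (codeword D β (cw m) j ≡ codeword D β (cw m') j [mod p ])))
theorem3p3 p t (suc (suc (suc (suc q₃)))) (suc (suc m)) p-prime _ (s≤s (s≤s (s≤s (s≤s _)))) (s≤s (s≤s _)) lam hλ b D
  ((block-size , _) , _ , r , replication , b≡v+r∸1) β (μ , hμ , _ , T , _ , _ , T-size , _ , pair-count , meets , _)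
  embeddable =
  vec ∘ codewordAt , weight ∘ codewordAt , (λ i _ _ _ _ → constant-on-classes (codewordAt i)) ,
  λ i i′ i≢i′ → pairCodewords-distinguished (i≢i′ ∘ remQuot-injective i i′)
  where
  open AffineDesign (suc (suc (suc q₃))) m (s≤s (s≤s (s≤s z≤n))) D β block-size r replication b≡v+r∸1
                    lam hλ μ hμ T T-size pair-count meets
  open Codes p p-prime embeddable
  open PairCodeword
  codewordAt : Fin ((p ∸ 1) * (k C 2)) → PairCodeword
  codewordAt i = let (c , w) = Fin.remQuot (k C 2) i in pairCodeword c w
  remQuot-injective : ∀ i i′ → Fin.remQuot {p ∸ 1} (k C 2) i ≡ Fin.remQuot (k C 2) i′ → i ≡ i′
  remQuot-injective i i′ eq = trans (sym (FinP.combine-remQuot {p ∸ 1} (k C 2) i))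
                                    (trans (cong (uncurry Fin.combine) eq) (FinP.combine-remQuot {p ∸ 1} (k C 2) i′))
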